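{- Let $n\ge1$ be an integer, $F_n(m)=\binom{n-m}{m}$ for $0\le m\le\lfloor n/2\rfloor$, and let $M$ be the smallest $m$ maximizing $F_n(m)$. Define $\mathcal{R}F_n(m)=\frac{F_n(m+1)}{F_n(m)}=\frac{(n-2m)(n-1-2m)}{(m+1)(n-m)}$ and $$\mathcal{R}\overline{B}_M(m)=\begin{cases}1 & \text{if } m\in\{M-1,M\},\\ \frac{2M-m}{m+1} & \text{otherwise.}\end{cases}$$ Then for every integer $m$ with $0\le m\le\lfloor n/2\rfloor-1$: $\mathcal{R}\overline{B}_M(m)<\mathcal{R}F_n(m)$ if and only if $m<M$.
   Context: $\mathcal{R}\overline{B}_M(m)$ is the ratio $B_M(m+1)/B_M(m)$ for the "Binomial Generator" weight $B_M(m)=\binom{2M}{m}$ ($m\ne M$), $B_M(M)=\binom{2M}{M+1}$; normalizing $B_M$ by a constant factor does not change this ratio. -}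

module Defs where

open import Data.Nat using (ℕ; zero; suc; _+_; _*_; _∸_; _≤_; _<_; _≟_; _/_)
open import Data.Nat.Combinatorics using (_C_)
open import Data.Integer using (ℤ; +_; _-_)
open import Data.Rational using (ℚ; 0ℚ; 1ℚ) renaming (_/_ to _÷_)
open import Data.Product using (_×_)
open import Relation.Nullary using (yes; no)

F : ℕ → ℕ → ℕ
F n m = (n ∸ m) C m

-- the rational a / b  (only used with b ≠ 0; value 0 when b = 0 is a dummy)
ratio : ℕ → ℕ → ℚ
ratio a zero    = 0ℚ
ratio a (suc b) = (+ a) ÷ suc b

RF : ℕ → ℕ → ℚ
RF n m = ratio (F n (suc m)) (F n m)

RBbar : ℕ → ℕ → ℚ
RBbar M m with m ≟ M | suc m ≟ M
... | yes _ | _ = 1ℚ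
... | no _ | yes _ = 1ℚ
... | no _ | no _ = ((+ (2 * M)) - (+ m)) ÷ suc m

half : ℕ → ℕ
half n = n / 2

IsSmallestMaximizer : ℕ → ℕ → Set
IsSmallestMaximizer n M =
  (M ≤ half n) × ((k : ℕ) → k ≤ half n → F n k ≤ F n M) × ((k : ℕ) → k < M → F n k < F n M)

module Submission where

-- Write n = 2 + m + m + e. By the absorption identities for binomial coefficients,
-- RF n m = (n - 2m)(n - 2m - 1) / ((m + 1)(n - m)), so each comparison in the statement
-- becomes a polynomial inequality over ℕ. For m ∈ {M - 1, M} the claim is just the
-- maximality of F n M and the minimality of M. Otherwise RBbar M m < RF n m reads
-- (2M - m)(n - m) < (n - 2m)(n - 2m - 1). With d = n - 2M, the facts F n (M - 1) < F n M
-- and F n (M + 1) ≤ F n M confine d to a window of width O(1) around φ M, and inside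
-- that window the inequality holds for m ≤ M - 2 and fails for m > M. Each polynomial
-- step is certified by an identity R + B = L + K + A with B ≤ A; only the case m > M
-- with M < 32, where the bound 3M + 5 ≤ 2d behind its certificate can fail, is settled
-- by evaluating a finite table.

open import Defs
open import Data.Nat using (ℕ; _≤_; _<_)
open import Data.Rational using () renaming (_<_ to _<ℚ_)
open import Function.Bundles using (_⇔_)

open import Data.Nat
  using (zero; suc; _+_; _*_; _∸_; _/_; _!; z<s; s≤s; NonZero; >-nonZero; >-nonZero⁻¹)
open import Data.Nat.Properties
open import Data.Nat.Combinatorics using (_C_; nCk≡n!/k![n-k]!; k![n∸k]!∣n!)
open import Data.Nat.DivMod using (m/n*n≡m; m/n*n≤m)
open import Data.Nat.Tactic.RingSolver using (solve-∀)
open import Data.Integer as ℤ using (+_; +<+)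
import Data.Integer.Properties as ℤ
import Data.Integer.Tactic.RingSolver as ℤ-Solver
open import Data.Rational as ℚ using (1ℚ)
open import Data.Rational.Properties using (toℚᵘ-mono-<; toℚᵘ-cancel-<; toℚᵘ-fromℚᵘ; fromℚᵘ-cong)
import Data.Rational.Unnormalised as ℚᵘ
import Data.Rational.Unnormalised.Properties as ℚᵘ
open import Data.Product using (_,_)
open import Function.Bundles using (mk⇔; Equivalence)
open import Function.Properties.Equivalence using (⇔-setoid)
open import Level using (0ℓ)
open import Relation.Binary.PropositionalEquality
import Relation.Binary.Reasoning.Setoid as SetoidReasoning
open import Relation.Nullary using (¬_; Dec; yes; no; contradiction)
open import Relation.Nullary.Decidable using (_→-dec_; ¬?; toWitness)

module ⇔-Reasoning = SetoidReasoning (⇔-setoid 0ℓ)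

C-factorial : ∀ p q → ((p + q) C p) * (p ! * q !) ≡ (p + q) !
C-factorial p q = begin
  ((p + q) C p) * (p ! * q !)                               ≡⟨ cong (λ r → ((p + q) C p) * (p ! * r !)) (m+n∸m≡n p q) ⟨
  ((p + q) C p) * (p ! * (p + q ∸ p) !)                     ≡⟨ cong (_* (p ! * (p + q ∸ p) !)) (nCk≡n!/k![n-k]! p≤p+q) ⟩
  (p + q) ! / (p ! * (p + q ∸ p) !) * (p ! * (p + q ∸ p) !) ≡⟨ m/n*n≡m (k![n∸k]!∣n! p≤p+q) ⟩
  (p + q) !                                                 ∎
  where
  open ≡-Reasoning
  p≤p+q = m≤m+n p q
  instance _ = p !* (p + q ∸ p) !≢0

C-pos : ∀ p q → 0 < (p + q) C p
C-pos p q = >-nonZero⁻¹ _ {{m*n≢0⇒m≢0 _ {{subst NonZero (sym (C-factorial p q)) ((p + q) !≢0)}}}}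

C-suc-ratio : ∀ p q →
  ((suc p + q) C suc p) * (suc p * (2 + p + q)) ≡ ((p + (2 + q)) C p) * ((2 + q) * (1 + q))
C-suc-ratio p q = *-cancelʳ-≡ _ _ (p ! * q !) {{p !* q !≢0}} (begin
  b * (suc p * (2 + p + q)) * (p ! * q !)  ≡⟨ regroupˡ b p q (p !) (q !) ⟩
  (2 + p + q) * (b * (suc p ! * q !))      ≡⟨ cong ((2 + p + q) *_) (C-factorial (suc p) q) ⟩
  (2 + p + q) !                            ≡⟨ cong _! (p+[2+q]≡2+p+q p q) ⟨
  (p + (2 + q)) !                          ≡⟨ C-factorial p (2 + q) ⟨
  a * (p ! * (2 + q) !)                    ≡⟨ regroupʳ a q (p !) (q !) ⟩
  a * ((2 + q) * (1 + q)) * (p ! * q !)    ∎)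
  where
  open ≡-Reasoning
  a = (p + (2 + q)) C p
  b = (suc p + q) C suc p
  regroupˡ : ∀ b p q x y → b * (suc p * (2 + p + q)) * (x * y) ≡ (2 + p + q) * (b * (suc p * x * y))
  regroupˡ = solve-∀
  regroupʳ : ∀ a q x y → a * (x * ((2 + q) * ((1 + q) * y))) ≡ a * ((2 + q) * (1 + q)) * (x * y)
  regroupʳ = solve-∀
  p+[2+q]≡2+p+q : ∀ p q → p + (2 + q) ≡ 2 + p + q
  p+[2+q]≡2+p+q = solve-∀

-- For n = 2 + m + m + e these are (n - 2m)(n - 2m - 1) and (m + 1)(n - m), the numerator
-- and denominator of RF n m.
rfNum : ℕ → ℕ
rfNum e = (2 + e) * (1 + e)

rfDen : ℕ → ℕ → ℕ
rfDen m e = suc m * (2 + m + e)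

F≡C : ∀ m e → F (2 + m + m + e) m ≡ (m + (2 + e)) C m
F≡C m e = cong (_C m) (trans (cong (_∸ m) (regroup m e)) (m+n∸m≡n m (m + (2 + e))))
  where
  regroup : ∀ m e → 2 + m + m + e ≡ m + (m + (2 + e))
  regroup = solve-∀

F-suc≡C : ∀ m e → F (2 + m + m + e) (suc m) ≡ (suc m + e) C suc m
F-suc≡C m e = cong (_C suc m) (trans (cong (_∸ suc m) (regroup m e)) (m+n∸m≡n (suc m) (suc m + e)))
  where
  regroup : ∀ m e → 2 + m + m + e ≡ suc m + (suc m + e)
  regroup = solve-∀

F-pos : ∀ m e → 0 < F (2 + m + m + e) m
F-pos m e = subst (0 <_) (sym (F≡C m e)) (C-pos m (2 + e))

F-suc-ratio : ∀ m e → F (2 + m + m + e) (suc m) * rfDen m e ≡ F (2 + m + m + e) m * rfNum e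
F-suc-ratio m e = begin
  F (2 + m + m + e) (suc m) * rfDen m e  ≡⟨ cong (_* rfDen m e) (F-suc≡C m e) ⟩
  ((suc m + e) C suc m) * rfDen m e      ≡⟨ C-suc-ratio m e ⟩
  ((m + (2 + e)) C m) * rfNum e          ≡⟨ cong (_* rfNum e) (F≡C m e) ⟨
  F (2 + m + m + e) m * rfNum e          ∎
  where open ≡-Reasoning

cross-multiply-<⇔ : ∀ {a b p q} → 0 < a → 0 < q → b * q ≡ a * p → (a < b ⇔ q < p)
cross-multiply-<⇔ {a} {b} {p} {q} 0<a 0<q bq≡ap = mk⇔
  (λ a<b → *-cancelˡ-< a q p (begin-strict
    a * q  <⟨ *-monoˡ-< q {{>-nonZero 0<q}} a<b ⟩
    b * q  ≡⟨ bq≡ap ⟩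
    a * p  ∎))
  (λ q<p → *-cancelʳ-< q a b (begin-strict
    a * q  <⟨ *-monoʳ-< a {{>-nonZero 0<a}} q<p ⟩
    a * p  ≡⟨ bq≡ap ⟨
    b * q  ∎))
  where open ≤-Reasoning

F<F-suc⇔rfDen<rfNum : ∀ {n} m e → 2 + m + m + e ≡ n → (F n m < F n (suc m) ⇔ rfDen m e < rfNum e)
F<F-suc⇔rfDen<rfNum m e refl = cross-multiply-<⇔ (F-pos m e) z<s (F-suc-ratio m e)

/-<-/⇔ : ∀ i j c d → (i ℚ./ suc c <ℚ j ℚ./ suc d) ⇔ (i ℤ.* + suc d ℤ.< j ℤ.* + suc c)
/-<-/⇔ i j c d = mk⇔
  (λ lt → ℚᵘ.drop-*<* (ℚᵘ.<-respʳ-≃ (toℚᵘ-fromℚᵘ qᵘ) (ℚᵘ.<-respˡ-≃ (toℚᵘ-fromℚᵘ pᵘ) (toℚᵘ-mono-< lt))))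
  (λ lt → toℚᵘ-cancel-< (ℚᵘ.<-respʳ-≃ (ℚᵘ.≃-sym (toℚᵘ-fromℚᵘ qᵘ))
                          (ℚᵘ.<-respˡ-≃ (ℚᵘ.≃-sym (toℚᵘ-fromℚᵘ pᵘ)) (ℚᵘ.*<* lt))))
  where
  pᵘ = ℚᵘ.mkℚᵘ i c
  qᵘ = ℚᵘ.mkℚᵘ j d

ratio-cross : ∀ {a b p q} → 0 < a → 0 < q → b * q ≡ a * p → ratio b a ≡ ratio p q
ratio-cross {suc a} {b} {p} {suc q} _ _ bq≡ap =
  fromℚᵘ-cong {ℚᵘ.mkℚᵘ (+ b) a} {ℚᵘ.mkℚᵘ (+ p) q} (ℚᵘ.*≡* (begin
    + b ℤ.* + suc q  ≡⟨ ℤ.pos-* b (suc q) ⟨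
    + (b * suc q)    ≡⟨ cong +_ (trans bq≡ap (*-comm (suc a) p)) ⟩
    + (p * suc a)    ≡⟨ ℤ.pos-* p (suc a) ⟩
    + p ℤ.* + suc a  ∎))
  where open ≡-Reasoning

RF-closed-form : ∀ {n} m e → 2 + m + m + e ≡ n → RF n m ≡ ratio (rfNum e) (rfDen m e)
RF-closed-form m e refl = ratio-cross (F-pos m e) z<s (F-suc-ratio m e)

+<+⇔ : ∀ m n → (+ m ℤ.< + n) ⇔ (m < n)
+<+⇔ m n = mk⇔ ℤ.drop‿+<+ +<+

ℤ+-cancelʳ-<⇔ : ∀ i j k → (i ℤ.+ k ℤ.< j ℤ.+ k) ⇔ (i ℤ.< j)
ℤ+-cancelʳ-<⇔ i j k = mk⇔
  (λ lt → subst₂ ℤ._<_ ([i+k]-k≡i i k) ([i+k]-k≡i j k) (ℤ.+-monoˡ-< (ℤ.- k) lt))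
  (ℤ.+-monoˡ-< k)
  where
  [i+k]-k≡i : ∀ i k → i ℤ.+ k ℤ.+ ℤ.- k ≡ i
  [i+k]-k≡i = ℤ-Solver.solve-∀

ℤ*-cancelʳ-<⇔ : ∀ i j c → (i ℤ.* + suc c ℤ.< j ℤ.* + suc c) ⇔ (i ℤ.< j)
ℤ*-cancelʳ-<⇔ i j c = mk⇔ (ℤ.*-cancelʳ-<-nonNeg (+ suc c)) (ℤ.*-monoʳ-<-pos (+ suc c))

[x-y]*a<w⇔x*a<w+y*a : ∀ x y a w → ((+ x ℤ.- + y) ℤ.* + a ℤ.< + w) ⇔ (x * a < w + y * a)
[x-y]*a<w⇔x*a<w+y*a x y a w = begin
  ((+ x ℤ.- + y) ℤ.* + a ℤ.< + w)                                 ≈⟨ ℤ+-cancelʳ-<⇔ _ _ (+ y ℤ.* + a) ⟨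
  ((+ x ℤ.- + y) ℤ.* + a ℤ.+ + y ℤ.* + a ℤ.< + w ℤ.+ + y ℤ.* + a) ≡⟨ cong₂ ℤ._<_ lhs rhs ⟩
  (+ (x * a) ℤ.< + (w + y * a))                                   ≈⟨ +<+⇔ _ _ ⟩
  (x * a < w + y * a)                                             ∎
  where
  open ⇔-Reasoning
  [i-j]k+jk≡ik : ∀ i j k → (i ℤ.- j) ℤ.* k ℤ.+ j ℤ.* k ≡ i ℤ.* k
  [i-j]k+jk≡ik = ℤ-Solver.solve-∀
  lhs : (+ x ℤ.- + y) ℤ.* + a ℤ.+ + y ℤ.* + a ≡ + (x * a)
  lhs = trans ([i-j]k+jk≡ik (+ x) (+ y) (+ a)) (sym (ℤ.pos-* x a))
  rhs : + w ℤ.+ + y ℤ.* + a ≡ + (w + y * a)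
  rhs = trans (cong (λ z → + w ℤ.+ z) (sym (ℤ.pos-* y a))) (sym (ℤ.pos-+ w (y * a)))

1<RF⇔F<F-suc : ∀ {n} m e → 2 + m + m + e ≡ n → (1ℚ <ℚ RF n m) ⇔ (F n m < F n (suc m))
1<RF⇔F<F-suc {n} m e n≡ = begin
  (1ℚ <ℚ RF n m)                               ≡⟨ cong (1ℚ <ℚ_) (RF-closed-form m e n≡) ⟩
  (1ℚ <ℚ ratio (rfNum e) (rfDen m e))          ≈⟨ /-<-/⇔ (+ 1) (+ rfNum e) 0 _ ⟩
  (+ 1 ℤ.* + rfDen m e ℤ.< + rfNum e ℤ.* + 1)  ≡⟨ cong₂ ℤ._<_ (ℤ.*-identityˡ _) (ℤ.*-identityʳ _) ⟩
  (+ rfDen m e ℤ.< + rfNum e)                  ≈⟨ +<+⇔ _ _ ⟩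
  (rfDen m e < rfNum e)                        ≈⟨ F<F-suc⇔rfDen<rfNum m e n≡ ⟨
  (F n m < F n (suc m))                        ∎
  where open ⇔-Reasoning

RBbar<RF : ℕ → ℕ → ℕ → Set
RBbar<RF M m e = 2 * M * (2 + m + e) < rfNum e + m * (2 + m + e)

RBbar<RF? : ∀ M m e → Dec (RBbar<RF M m e)
RBbar<RF? M m e = 2 * M * (2 + m + e) <? rfNum e + m * (2 + m + e)

[2M-m]/[m+1]<RF⇔RBbar<RF : ∀ {n} M m e → 2 + m + m + e ≡ n →
  (((+ (2 * M)) ℤ.- (+ m)) ℚ./ suc m <ℚ RF n m) ⇔ RBbar<RF M m e
[2M-m]/[m+1]<RF⇔RBbar<RF {n} M m e n≡ = begin
  (x ℚ./ suc m <ℚ RF n m)                                      ≡⟨ cong (x ℚ./ suc m <ℚ_) (RF-closed-form m e n≡) ⟩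
  (x ℚ./ suc m <ℚ ratio (rfNum e) (rfDen m e))                 ≈⟨ /-<-/⇔ x (+ rfNum e) m _ ⟩
  (x ℤ.* + rfDen m e ℤ.< + rfNum e ℤ.* + suc m)                ≡⟨ cong (ℤ._< + rfNum e ℤ.* + suc m) split-rfDen ⟩
  (x ℤ.* + (2 + m + e) ℤ.* + suc m ℤ.< + rfNum e ℤ.* + suc m)  ≈⟨ ℤ*-cancelʳ-<⇔ _ _ m ⟩
  (x ℤ.* + (2 + m + e) ℤ.< + rfNum e)                          ≈⟨ [x-y]*a<w⇔x*a<w+y*a (2 * M) m _ _ ⟩
  RBbar<RF M m e                                               ∎
  where
  open ⇔-Reasoning
  x = (+ (2 * M)) ℤ.- (+ m)
  regroup : ∀ i j k → i ℤ.* (j ℤ.* k) ≡ i ℤ.* k ℤ.* j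
  regroup = ℤ-Solver.solve-∀
  split-rfDen : x ℤ.* + rfDen m e ≡ x ℤ.* + (2 + m + e) ℤ.* + suc m
  split-rfDen = trans (cong (x ℤ.*_) (ℤ.pos-* (suc m) (2 + m + e))) (regroup x (+ suc m) (+ (2 + m + e)))

≤-via-identity : ∀ L R A B K → R + B ≡ L + K + A → B ≤ A → L + K ≤ R
≤-via-identity L R A B K R+B≡L+K+A B≤A = +-cancelʳ-≤ B (L + K) R (begin
  L + K + B  ≤⟨ +-monoʳ-≤ (L + K) B≤A ⟩
  L + K + A  ≡⟨ R+B≡L+K+A ⟨
  R + B      ∎)
  where open ≤-Reasoning

rising⇒3M≤2d+6 : ∀ M d → M * (1 + M + d) < rfNum d → 3 * M ≤ 2 * d + 6
rising⇒3M≤2d+6 M d rising with 3 * M ≤? 2 * d + 6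
... | yes 3M≤2d+6 = 3M≤2d+6
... | no 3M≰2d+6  = contradiction rising (≤⇒≯ (*-cancelˡ-≤ 9 (≤-trans (m≤m+n _ _) balance)))
  where
  c = 3 * M + 5 * d + 10
  slack = d * d + 28 * d + 52
  identity : ∀ M d → let c = 3 * M + 5 * d + 10 in
    9 * (M * (1 + M + d)) + c * (1 + (2 * d + 6))
    ≡ 9 * ((2 + d) * (1 + d)) + (d * d + 28 * d + 52) + c * (3 * M)
  identity = solve-∀
  balance : 9 * rfNum d + slack ≤ 9 * (M * (1 + M + d))
  balance = ≤-via-identity (9 * rfNum d) (9 * (M * (1 + M + d))) (c * (3 * M)) (c * (1 + (2 * d + 6)))
    slack (identity M d) (*-monoʳ-≤ c (≰⇒> 3M≰2d+6))

-- False for some M ≤ 30; those M are handled by ¬RBbar<RF-above-table.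
rising⇒3M+5≤2d : ∀ M d → 32 ≤ M → M * (1 + M + d) < rfNum d → 3 * M + 5 ≤ 2 * d
rising⇒3M+5≤2d M d 32≤M rising with 3 * M + 5 ≤? 2 * d
... | yes 3M+5≤2d = 3M+5≤2d
... | no 3M+5≰2d  = contradiction rising (≤⇒≯ (*-cancelˡ-≤ 4 (≤-trans (m≤m+n _ _) balance)))
  where
  M′ = M ∸ 32
  c = M + 10 + 2 * d
  slack = M′ * M′ + 34 * M′ + 16
  identity : ∀ M′ d → let M = 32 + M′; c = M + 10 + 2 * d in
    4 * (M * (1 + M + d)) + c * (1 + 2 * d)
    ≡ 4 * ((2 + d) * (1 + d)) + (M′ * M′ + 34 * M′ + 16) + c * (3 * M + 5)
  identity = solve-∀
  balance : 4 * rfNum d + slack ≤ 4 * (M * (1 + M + d))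
  balance = ≤-via-identity (4 * rfNum d) (4 * (M * (1 + M + d))) (c * (3 * M + 5)) (c * (1 + 2 * d)) slack
    (subst (λ M → 4 * (M * (1 + M + d)) + (M + 10 + 2 * d) * (1 + 2 * d)
                  ≡ 4 * rfNum d + slack + (M + 10 + 2 * d) * (3 * M + 5))
           (m+[n∸m]≡n 32≤M) (identity M′ d))
    (*-monoʳ-≤ c (≰⇒> 3M+5≰2d))

falling⇒f≤2+M+M : ∀ M f → rfNum f ≤ rfDen M f → f ≤ 2 + M + M
falling⇒f≤2+M+M M f falling with f ≤? 2 + M + M
... | yes f≤2+M+M = f≤2+M+M
... | no f≰2+M+M with m≤n⇒∃[o]m+o≡n (≰⇒> f≰2+M+M)
...   | t , refl = contradiction falling (<⇒≱ (begin-strict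
  rfDen M f              <⟨ m<m+n (rfDen M f) z<s ⟩
  rfDen M f + suc slack  ≡⟨ expand M t ⟨
  rfNum f                ∎))
  where
  open ≤-Reasoning
  slack = M * M + 3 * M * t + 10 * M + 8 * t + t * t + 14
  expand : ∀ M t → let f = 3 + M + M + t in
    (2 + f) * (1 + f) ≡ suc M * (2 + M + f) + suc (M * M + 3 * M * t + 10 * M + 8 * t + t * t + 14)
  expand = solve-∀

RBbar<RF-far-below : ∀ m j d → let M = 2 + m + j in
  M * (1 + M + d) < rfNum d → RBbar<RF M m (2 + j + j + d)
RBbar<RF-far-below m j d rising = *-cancelˡ-< 2 _ _ (<-≤-trans (m<m+n (2 * (2 * M * W)) z<s) balance)
  where
  M = 2 + m + j
  e = 2 + j + j + d
  W = 2 + m + e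
  c = 3 * j + 2
  slack = 5 * M * j + 6 * j * j + 2 * j + 1
  identity : ∀ m j d → let M = 2 + m + j; e = 2 + j + j + d; W = 2 + m + e; c = 3 * j + 2 in
    2 * ((2 + e) * (1 + e) + m * W) + (2 * (1 + M * (1 + M + d)) + c * (3 * M))
    ≡ 2 * (2 * M * W) + suc (5 * M * j + 6 * j * j + 2 * j + 1) + (2 * ((2 + d) * (1 + d)) + c * (2 * d + 6))
  identity = solve-∀
  balance : 2 * (2 * M * W) + suc slack ≤ 2 * (rfNum e + m * W)
  balance = ≤-via-identity (2 * (2 * M * W)) (2 * (rfNum e + m * W))
    (2 * rfNum d + c * (2 * d + 6)) (2 * (1 + M * (1 + M + d)) + c * (3 * M)) (suc slack) (identity m j d)
    (+-mono-≤ (*-monoʳ-≤ 2 rising) (*-monoʳ-≤ c (rising⇒3M≤2d+6 M d rising)))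

¬RBbar<RF-above-large : ∀ M k e → let f = 2 + k + k + e in
  rfNum f ≤ rfDen M f → 3 * M + 5 ≤ 2 * (2 + f) → ¬ RBbar<RF M (suc M + k) e
¬RBbar<RF-above-large M k e falling gap = ≤⇒≯ (*-cancelˡ-≤ 3 (≤-trans (m≤m+n _ _) balance))
  where
  m = suc M + k
  f = 2 + k + k + e
  W = 2 + m + e
  c = 2 * k + 3
  slack = k * k + 6 * k + 5 * k * e
  identity : ∀ M k e → let m = suc M + k; f = 2 + k + k + e; W = 2 + m + e; c = 2 * k + 3 in
    3 * (2 * M * W) + (3 * ((2 + f) * (1 + f)) + c * (3 * M + 5))
    ≡ 3 * ((2 + e) * (1 + e) + m * W) + (k * k + 6 * k + 5 * k * e)
      + (3 * (suc M * (2 + M + f)) + c * (2 * (2 + f)))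
  identity = solve-∀
  balance : 3 * (rfNum e + m * W) + slack ≤ 3 * (2 * M * W)
  balance = ≤-via-identity (3 * (rfNum e + m * W)) (3 * (2 * M * W))
    (3 * rfDen M f + c * (2 * (2 + f))) (3 * rfNum f + c * (3 * M + 5)) slack (identity M k e)
    (+-mono-≤ (*-monoʳ-≤ 3 falling) (*-monoʳ-≤ c gap))

-- Decided by evaluation; the ranges of f and k are those allowed by falling⇒f≤2+M+M.
¬RBbar<RF-above-table : ∀ {M} → M < 32 →
  ∀ {f} → f < 3 + M + M → M * (1 + M + (2 + f)) < rfNum (2 + f) → rfNum f ≤ rfDen M f →
  ∀ {k} → k < 3 + M + M → 2 + k + k ≤ f → ¬ RBbar<RF M (suc M + k) (f ∸ (2 + k + k))
¬RBbar<RF-above-table = toWitness {a? = allUpTo? (λ M → allUpTo? (λ f →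
  (M * (1 + M + (2 + f)) <? rfNum (2 + f)) →-dec ((rfNum f ≤? rfDen M f) →-dec allUpTo? (λ k →
  (2 + k + k ≤? f) →-dec ¬? (RBbar<RF? M (suc M + k) (f ∸ (2 + k + k)))) (3 + M + M))) (3 + M + M)) 32} _

¬RBbar<RF-above-small : ∀ {M} → M < 32 → ∀ k e → let f = 2 + k + k + e in
  M * (1 + M + (2 + f)) < rfNum (2 + f) → rfNum f ≤ rfDen M f → ¬ RBbar<RF M (suc M + k) e
¬RBbar<RF-above-small {M} M<32 k e rising falling =
  subst (λ x → ¬ RBbar<RF M (suc M + k) x) (m+n∸m≡n (2 + k + k) e) table-entry
  where
  f = 2 + k + k + e
  f<3+M+M : f < 3 + M + M
  f<3+M+M = s≤s (falling⇒f≤2+M+M M f falling)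
  k≤f : k ≤ f
  k≤f = ≤-trans (m≤n+m k 2) (≤-trans (m≤m+n (2 + k) k) (m≤m+n (2 + k + k) e))
  table-entry : ¬ RBbar<RF M (suc M + k) (f ∸ (2 + k + k))
  table-entry = ¬RBbar<RF-above-table M<32 f<3+M+M rising falling (≤-<-trans k≤f f<3+M+M) (m≤m+n (2 + k + k) e)

¬RBbar<RF-above : ∀ M k e → let f = 2 + k + k + e in
  M * (1 + M + (2 + f)) < rfNum (2 + f) → rfNum f ≤ rfDen M f → ¬ RBbar<RF M (suc M + k) e
¬RBbar<RF-above M k e rising falling with M <? 32
... | yes M<32 = ¬RBbar<RF-above-small M<32 k e rising falling
... | no M≮32  = ¬RBbar<RF-above-large M k e falling
                   (rising⇒3M+5≤2d M (2 + (2 + k + k + e)) (≮⇒≥ M≮32) rising)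

rising-into-smallest-maximizer : ∀ {n} M d → M + M + d ≡ n → (∀ k → k < M → F n k < F n M) →
  M * (1 + M + d) < rfNum d
rising-into-smallest-maximizer zero     d _  _        = z<s
rising-into-smallest-maximizer (suc M′) d n≡ smallest =
  Equivalence.to (F<F-suc⇔rfDen<rfNum M′ d (trans (regroup M′ d) n≡)) (smallest M′ ≤-refl)
  where
  regroup : ∀ M′ d → 2 + M′ + M′ + d ≡ suc M′ + suc M′ + d
  regroup = solve-∀

falling-after-maximizer : ∀ {n} M f → 2 + M + M + f ≡ n → F n (suc M) ≤ F n M → rfNum f ≤ rfDen M f
falling-after-maximizer M f n≡ maximal =
  ≮⇒≥ (λ den<num → ≤⇒≯ maximal (Equivalence.from (F<F-suc⇔rfDen<rfNum M f n≡) den<num))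

RBbar-self : ∀ M → RBbar M M ≡ 1ℚ
RBbar-self M with M ≟ M | suc M ≟ M
... | yes _  | _ = refl
... | no M≢M | _ = contradiction refl M≢M

RBbar-pred : ∀ m → RBbar (suc m) m ≡ 1ℚ
RBbar-pred m with m ≟ suc m | suc m ≟ suc m
... | yes _ | _        = refl
... | no _  | yes _    = refl
... | no _  | no m+1≢m+1 = contradiction refl m+1≢m+1

RBbar-below : ∀ {M m} → suc m < M → RBbar M m ≡ ((+ (2 * M)) ℤ.- (+ m)) ℚ./ suc m
RBbar-below {M} {m} m+1<M with m ≟ M | suc m ≟ M
... | yes m≡M | _          = contradiction m≡M (<⇒≢ (<-trans (n<1+n m) m+1<M))
... | no _    | yes m+1≡M  = contradiction m+1≡M (<⇒≢ m+1<M)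
... | no _    | no _       = refl

RBbar-above : ∀ {M m} → M < m → RBbar M m ≡ ((+ (2 * M)) ℤ.- (+ m)) ℚ./ suc m
RBbar-above {M} {m} M<m with m ≟ M | suc m ≟ M
... | yes m≡M | _          = contradiction m≡M (>⇒≢ M<m)
... | no _    | yes m+1≡M  = contradiction m+1≡M (>⇒≢ (m<n⇒m<1+n M<m))
... | no _    | no _       = refl

data Position : ℕ → ℕ → Set where
  far-below  : ∀ m j → Position m (2 + m + j)
  just-below : ∀ m → Position m (suc m)
  equal      : ∀ m → Position m m
  above      : ∀ M k → Position (suc M + k) M

position-suc : ∀ {m M} → Position m M → Position (suc m) (suc M)
position-suc (far-below m j) = far-below (suc m) j
position-suc (just-below m)  = just-below (suc m)
position-suc (equal m)       = equal (suc m)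
position-suc (above M k)     = above (suc M) k

position : ∀ m M → Position m M
position zero    zero          = equal zero
position zero    (suc zero)    = just-below zero
position zero    (suc (suc j)) = far-below zero j
position (suc m) zero          = above zero m
position (suc m) (suc M)       = position-suc (position m M)

crossing : ∀ {m M} → Position m M → ∀ {n} e → 2 + m + m + e ≡ n → M + M ≤ n →
  (M ≤ m → F n (suc M) ≤ F n M) → (∀ k → k < M → F n k < F n M) →
  (RBbar M m <ℚ RF n m) ⇔ (m < M)
crossing (equal m) e n≡ _ maximal _ rewrite RBbar-self m = mk⇔
  (λ 1<RF → contradiction (Equivalence.to (1<RF⇔F<F-suc m e n≡) 1<RF) (≤⇒≯ (maximal ≤-refl)))
  (λ m<m → contradiction m<m (<-irrefl refl))
crossing (just-below m) e n≡ _ _ smallest rewrite RBbar-pred m = mk⇔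
  (λ _ → ≤-refl)
  (λ _ → Equivalence.from (1<RF⇔F<F-suc m e n≡) (smallest m ≤-refl))
crossing (far-below m j) {n} e n≡ M+M≤n _ smallest rewrite RBbar-below (s≤s (s≤s (m≤m+n m j))) = mk⇔
  (λ _ → m<M)
  (λ _ → Equivalence.from ([2M-m]/[m+1]<RF⇔RBbar<RF M m e n≡) (subst (RBbar<RF M m) (sym e≡) below))
  where
  M = 2 + m + j
  m<M : m < M
  m<M = <-trans (n<1+n m) (s≤s (s≤s (m≤m+n m j)))
  d = n ∸ (M + M)
  M+M+d≡n : M + M + d ≡ n
  M+M+d≡n = m+[n∸m]≡n M+M≤n
  regroup : ∀ m j d → (2 + m + j) + (2 + m + j) + d ≡ 2 + m + m + (2 + j + j + d)
  regroup = solve-∀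
  e≡ : e ≡ 2 + j + j + d
  e≡ = +-cancelˡ-≡ (2 + m + m) e _ (trans n≡ (trans (sym M+M+d≡n) (regroup m j d)))
  below : RBbar<RF M m (2 + j + j + d)
  below = RBbar<RF-far-below m j d (rising-into-smallest-maximizer M d M+M+d≡n smallest)
crossing (above M k) e n≡ _ maximal smallest rewrite RBbar-above (s≤s (m≤m+n M k)) = mk⇔
  (λ RB<RF → contradiction (Equivalence.to ([2M-m]/[m+1]<RF⇔RBbar<RF M m e n≡) RB<RF) not-below)
  (λ m<M → contradiction M<m (<⇒≯ m<M))
  where
  m = suc M + k
  f = 2 + k + k + e
  M<m : M < m
  M<m = s≤s (m≤m+n M k)
  regroup₁ : ∀ M k e → M + M + (2 + (2 + k + k + e)) ≡ 2 + (suc M + k) + (suc M + k) + e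
  regroup₁ = solve-∀
  regroup₂ : ∀ M k e → 2 + M + M + (2 + k + k + e) ≡ 2 + (suc M + k) + (suc M + k) + e
  regroup₂ = solve-∀
  not-below : ¬ RBbar<RF M m e
  not-below = ¬RBbar<RF-above M k e
    (rising-into-smallest-maximizer M (2 + f) (trans (regroup₁ M k e) n≡) smallest)
    (falling-after-maximizer M f (trans (regroup₂ M k e) n≡) (maximal (<⇒≤ M<m)))

k≤half⇒k+k≤n : ∀ {k n} → k ≤ half n → k + k ≤ n
k≤half⇒k+k≤n {k} {n} k≤half = begin
  k + k        ≡⟨ cong (λ x → k + x) (+-identityʳ k) ⟨
  2 * k        ≤⟨ *-monoʳ-≤ 2 k≤half ⟩
  2 * (n / 2)  ≡⟨ *-comm 2 (n / 2) ⟩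
  n / 2 * 2    ≤⟨ m/n*n≤m n 2 ⟩
  n            ∎
  where open ≤-Reasoning

lemma5 : (n : ℕ) → 1 ≤ n → (M : ℕ) → IsSmallestMaximizer n M →
    (m : ℕ) → m < half n →
    ((RBbar M m <ℚ RF n m) ⇔ (m < M))
lemma5 n _ M (M≤half , maximal , smallest) m m<half =
  crossing (position m M) e n≡ (k≤half⇒k+k≤n M≤half)
    (λ M≤m → maximal (suc M) (≤-trans (s≤s M≤m) m<half)) smallest
  where
  e = n ∸ (2 + m + m)
  n≡ : 2 + m + m + e ≡ n
  n≡ = m+[n∸m]≡n (subst (_≤ n) (cong suc (+-suc m m)) (k≤half⇒k+k≤n m<half))
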